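{- Let $C$ be a finite chain and $A$ a sub-digraph of $C$. Then, with the downsets of $C$ linearly ordered by inclusion, the graph $G(C,A)$ satisfies: whenever $D_1\subseteq D_2\subseteq D_3\subseteq D_4$ are downsets of $C$ with $D_1\sim D_4$, then $D_2\sim D_3$. In particular $G(C,A)$ is a proper interval graph.
   Context: A poset $P$ is viewed as a reflexive digraph with an arc $(a,b)$ whenever $a\le b$ (including loops); a sub-digraph $A$ of $P$ has the same vertex set and a subset of the arcs. The graph $G(P,A)$ has vertex set the set of downsets of $P$, with $D\sim D'$ iff $A$ contains every arc $(x,y)$ of $P$ for which $x,y$ both lie in $D\setminus D'$ or both lie in $D'\setminus D$. A reflexive graph is a proper interval graph if its vertices admit a linear order such that $u'\le u\le v\le v'$ and $u'\sim v'$ imply $u\sim v$. -}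

module Defs where

open import Level using (0ℓ)
open import Data.Nat using (ℕ)
open import Data.Fin using (Fin) renaming (_≤_ to _≤ᶠ_)
open import Data.Fin.Subset using (Subset; _∈_; _∉_; _⊆_)
open import Data.Product using (Σ; Σ-syntax; ∃; _×_; proj₁)
open import Data.Sum using (_⊎_)
open import Relation.Binary.PropositionalEquality using (_≡_)
open import Relation.Binary.Structures using (IsTotalOrder)

-- The finite chain C with n elements is Fin n with its usual order _≤ᶠ_.
-- Viewed as a reflexive digraph, its arcs are the pairs (x , y) with x ≤ y.

SubDigraph : ℕ → Set₁
SubDigraph n = Σ[ A ∈ (Fin n → Fin n → Set) ] (∀ {x y} → A x y → x ≤ᶠ y)

arcs : ∀ {n} → SubDigraph n → Fin n → Fin n → Set
arcs = proj₁

IsDownset : ∀ {n} → Subset n → Set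
IsDownset {n} D = ∀ {x y : Fin n} → y ≤ᶠ x → x ∈ D → y ∈ D

Downset : ℕ → Set
Downset n = Σ[ D ∈ Subset n ] IsDownset D

_∈_∖_ : ∀ {n} → Fin n → Subset n → Subset n → Set
x ∈ D ∖ D' = x ∈ D × x ∉ D'

Adj : ∀ {n} → SubDigraph n → Subset n → Subset n → Set
Adj {n} A D D' =
  ∀ (x y : Fin n) → x ≤ᶠ y →
    ((x ∈ D ∖ D' × y ∈ D ∖ D') ⊎ (x ∈ D' ∖ D × y ∈ D' ∖ D)) →
    arcs A x y

G : ∀ {n} → SubDigraph n → Downset n → Downset n → Set
G A D D' = Adj A (proj₁ D) (proj₁ D')

_≈ᴰ_ : ∀ {n} → Downset n → Downset n → Set
D ≈ᴰ D' = proj₁ D ≡ proj₁ D'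

IsProperInterval : (V : Set) (_≈_ : V → V → Set) (_∼_ : V → V → Set) → Set₁
IsProperInterval V _≈_ _∼_ =
  ∃ λ (_≼_ : V → V → Set) → IsTotalOrder _≈_ _≼_ ×
    (∀ {u' u v v'} → u' ≼ u → u ≼ v → v ≼ v' → u' ∼ v' → u ∼ v)

-- Shrinking a pair D ⊆ D' to an inner pair only shrinks D' ∖ D, so fewer arcs
-- of C have to lie in A.  Downsets of a chain are nested (if x ∈ D ∖ D', every
-- element of D' lies below x), so inclusion is a linear order on the vertices
-- of G(C,A), and the first property is exactly the proper interval condition.
module Submission where

open import Defs
open import Data.Nat using (ℕ)
open import Data.Fin.Properties using (any?; ≤-total)
open import Data.Fin.Subset using (Subset; _⊆_)
open import Data.Fin.Subset.Properties using (_∈?_; ⊆-isPartialOrder)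
open import Data.Product using (_×_; _,_; proj₁)
open import Data.Sum using (_⊎_; inj₁; inj₂)
open import Function using (_on_)
open import Relation.Nullary using (yes; no; ¬?; _×-dec_)
open import Relation.Nullary.Decidable using (decidable-stable)
open import Relation.Nullary.Negation using (contradiction)
open import Relation.Binary.Structures using (IsTotalOrder)
import Relation.Binary.Construct.On as On

module _ {n : ℕ} where

  Adj-inward : (A : SubDigraph n) {D₁ D₂ D₃ D₄ : Subset n} →
    D₁ ⊆ D₂ → D₂ ⊆ D₃ → D₃ ⊆ D₄ → Adj A D₁ D₄ → Adj A D₂ D₃
  Adj-inward A D₁⊆D₂ D₂⊆D₃ D₃⊆D₄ adj x y x≤y (inj₁ ((x∈D₂ , x∉D₃) , _)) =
    contradiction (D₂⊆D₃ x∈D₂) x∉D₃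
  Adj-inward A {D₁} {D₂} {D₃} {D₄} D₁⊆D₂ D₂⊆D₃ D₃⊆D₄ adj x y x≤y
    (inj₂ ((x∈D₃ , x∉D₂) , (y∈D₃ , y∉D₂))) =
    adj x y x≤y (inj₂ (widen (x∈D₃ , x∉D₂) , widen (y∈D₃ , y∉D₂)))
    where
    widen : ∀ {z} → z ∈ D₃ ∖ D₂ → z ∈ D₄ ∖ D₁
    widen (z∈D₃ , z∉D₂) = D₃⊆D₄ z∈D₃ , λ z∈D₁ → z∉D₂ (D₁⊆D₂ z∈D₁)

  ∈∖⇒⊇ : {D D' : Subset n} → IsDownset D → IsDownset D' →
    ∀ {x} → x ∈ D ∖ D' → D' ⊆ D
  ∈∖⇒⊇ D↓ D'↓ {x} (x∈D , x∉D') {y} y∈D' with ≤-total y x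
  ... | inj₁ y≤x = D↓ y≤x x∈D
  ... | inj₂ x≤y = contradiction (D'↓ x≤y y∈D') x∉D'

  downset-⊆-total : (D D' : Downset n) → proj₁ D ⊆ proj₁ D' ⊎ proj₁ D' ⊆ proj₁ D
  downset-⊆-total (D , D↓) (D' , D'↓) with any? (λ x → (x ∈? D) ×-dec ¬? (x ∈? D'))
  ... | yes (x , x∈D∖D') = inj₂ (∈∖⇒⊇ D↓ D'↓ x∈D∖D')
  ... | no ∄x∈D∖D' = inj₁ λ {x} x∈D →
    decidable-stable (x ∈? D') λ x∉D' → ∄x∈D∖D' (x , x∈D , x∉D')

  downset-⊆-isTotalOrder : IsTotalOrder {A = Downset n} _≈ᴰ_ (_⊆_ on proj₁)
  downset-⊆-isTotalOrder = record
    { isPartialOrder = On.isPartialOrder proj₁ (⊆-isPartialOrder n)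
    ; total = downset-⊆-total
    }

fact4p5 : (n : ℕ) (A : SubDigraph n) →
    (∀ (D₁ D₂ D₃ D₄ : Downset n) →
      proj₁ D₁ ⊆ proj₁ D₂ → proj₁ D₂ ⊆ proj₁ D₃ → proj₁ D₃ ⊆ proj₁ D₄ →
      G A D₁ D₄ → G A D₂ D₃)
    × IsProperInterval (Downset n) _≈ᴰ_ (G A)
fact4p5 n A =
  (λ _ _ _ _ → Adj-inward A) ,
  (_⊆_ on proj₁) , downset-⊆-isTotalOrder , Adj-inward A
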